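{- Let $s_7(n)=\sum_{k=0}^n\binom{n}{k}^2\binom{n+k}{k}\binom{2k}{n}$ and $s_{18}(n)=\sum_{k=0}^{n}(-1)^k\binom{n}{k}\binom{2k}{k}\binom{2(n-k)}{n-k}\binom{2n-3k}{n}$ for $n\ge0$. For any prime $p$: $s_7(p-j)\equiv0\pmod p$ whenever $1\le j\le(p+1)/3$, and $s_{18}(p-j)\equiv0\pmod p$ whenever $1\le j\le(p+2)/4$.
   Context: For integers $m\ge0$ and any number $x$, $\binom{x}{m}=\frac{x(x-1)\cdots(x-m+1)}{m!}$ (so the upper entry $2n-3k$ may be negative). Equivalently, $s_{18}(0)=1$ and for $n\ge1$, $s_{18}(n)=\sum_{k=0}^{\lfloor n/3\rfloor}(-1)^k\binom{n}{k}\binom{2k}{k}\binom{2(n-k)}{n-k}\bigl[\binom{2n-3k-1}{n}+\binom{2n-3k}{n}\bigr]$. -}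

module Defs where

open import Data.Nat as ℕ using (ℕ; zero; suc)
open import Data.Nat.Combinatorics using (_C_)
open import Data.Nat.Properties using (_!≢0)
open import Data.Nat.Base using (_!)
open import Data.Integer as ℤ using (ℤ; +_; _-_; _*_)
open import Data.Integer.DivMod using (_/ℕ_)
open import Data.List using (List; map; upTo; foldr)

sumℕ : ℕ → (ℕ → ℕ) → ℕ
sumℕ n f = foldr ℕ._+_ 0 (map f (upTo (suc n)))

sumℤ : ℕ → (ℕ → ℤ) → ℤ
sumℤ n f = foldr ℤ._+_ (+ 0) (map f (upTo (suc n)))

falling : ℤ → ℕ → ℤ
falling x zero    = + 1
falling x (suc m) = x * falling (x - + 1) m

-- generalised binomial coefficient  binom(x, m) = x(x-1)...(x-m+1)/m!
-- (the division is exact)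
gbinom : ℤ → ℕ → ℤ
gbinom x m = _/ℕ_ (falling x m) (m !) {{m !≢0}}

s7 : ℕ → ℕ
s7 n = sumℕ n (λ k → (n C k) ℕ.* (n C k) ℕ.* ((n ℕ.+ k) C k) ℕ.* ((2 ℕ.* k) C n))

sgn : ℕ → ℤ
sgn zero    = + 1
sgn (suc k) = ℤ.- sgn k

s18 : ℕ → ℤ
s18 n = sumℤ n (λ k →
  sgn k * + ((n C k) ℕ.* ((2 ℕ.* k) C k) ℕ.* ((2 ℕ.* (n ℕ.∸ k)) C (n ℕ.∸ k)))
        * gbinom (+ (2 ℕ.* n) - + (3 ℕ.* k)) n)

{-# OPTIONS --safe #-}
-- Every summand is divisible by p. Write p = n + j. In s₇(n), a summand with k ≥ j has
-- k, n < p ≤ n + k, so p divides C(n+k,k); for k < j the bound 3j ≤ p + 1 gives 2k < n,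
-- so C(2k,n) = 0. In s₁₈(n), with m = n − k, p divides C(2k,k) when 2k ≥ p and C(2m,m)
-- when 2m ≥ p; otherwise the bound 4j ≤ p + 2 forces m < 2k and k < 2m, hence
-- 0 ≤ 2n − 3k < n and the generalised binomial C(2n − 3k, n) vanishes.
module Submission where

open import Defs
open import Data.Nat using (ℕ; _≤_; _∸_; _+_; _/_)
open import Data.Nat.Primality using (Prime)
open import Data.Nat.Divisibility using (_∣_)
open import Data.Integer using (+_)
open import Data.Integer.Divisibility renaming (_∣_ to _∣ℤ_)
open import Data.Product using (_×_)

open import Data.Nat
  using (zero; suc; _*_; _<_; s≤s; s≤s⁻¹; NonZero; >-nonZero; nonTrivial⇒n>1; _≤?_; _!)
open import Data.Nat.Properties
open import Data.Nat.Divisibility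
  using (_∤_; _∣0; ∣m∣n⇒∣m+n; ∣m⇒∣m*n; ∣n⇒∣m*n; m∣m*n; ∣⇒≤; ∣-trans; m≤n⇒m!∣n!)
open import Data.Nat.DivMod using (m/n*n≡m; m/n*n≤m; 0/n≡0)
open import Data.Nat.Combinatorics using (_C_; k![n∸k]!∣n!)
open import Data.Nat.Combinatorics.Specification using (nCk≡n!/k![n-k]!; k>n⇒nCk≡0)
open import Data.Nat.Primality using (euclidsLemma; prime⇒nonZero; prime⇒nonTrivial)
open import Data.Nat.Tactic.RingSolver using (solve)
open import Data.Integer as ℤ using (ℤ)
import Data.Integer.Properties as ℤ
import Data.Integer.Divisibility.Signed as ℤ
open import Data.List using ([]; _∷_; map; upTo)
open import Data.List.Properties using (foldr-preservesᵇ)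
open import Data.List.Relation.Unary.All as All using (All)
open import Data.List.Relation.Unary.All.Properties using (map⁺; all-upTo)
open import Data.Product using (_,_)
open import Data.Sum using (inj₁; inj₂)
open import Relation.Nullary using (yes; no; contradiction)
open import Relation.Binary.PropositionalEquality
open ≤-Reasoning

all-map-upTo : ∀ {a} {A : Set a} {P : A → Set} n (f : ℕ → A) →
               (∀ k → k ≤ n → P (f k)) → All P (map f (upTo (suc n)))
all-map-upTo n f h = map⁺ (All.map (λ {k} k<1+n → h k (s≤s⁻¹ k<1+n)) (all-upTo (suc n)))

∣-sumℕ : ∀ {d} n (f : ℕ → ℕ) → (∀ k → k ≤ n → d ∣ f k) → d ∣ sumℕ n f
∣-sumℕ {d} n f h = foldr-preservesᵇ {P = d ∣_} ∣m∣n⇒∣m+n (_ ∣0) (all-map-upTo n f h)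

∣-sumℤ : ∀ {d} n (f : ℕ → ℤ) → (∀ k → k ≤ n → d ℤ.∣ f k) → d ℤ.∣ sumℤ n f
∣-sumℤ {d} n f h = foldr-preservesᵇ {P = d ℤ.∣_} ℤ.∣m∣n⇒∣m+n (ℤ.∣ᵤ⇒∣ (_ ∣0)) (all-map-upTo n f h)

m≤n/o⇒o*m≤n : ∀ m n o .{{_ : NonZero o}} → m ≤ n / o → o * m ≤ n
m≤n/o⇒o*m≤n m n o m≤n/o = begin
  o * m       ≡⟨ *-comm o m ⟩
  m * o       ≤⟨ *-monoˡ-≤ o m≤n/o ⟩
  n / o * o   ≤⟨ m/n*n≤m n o ⟩
  n           ∎

[1+d]*j≤p+c⇒j≤p : ∀ {c d j p} → c ≤ d → 1 ≤ j → suc d * j ≤ p + c → j ≤ p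
[1+d]*j≤p+c⇒j≤p {c} {d} {j} {p} c≤d 1≤j [1+d]*j≤p+c = +-cancelʳ-≤ c j p (begin
  j + c      ≤⟨ +-monoʳ-≤ j c≤d ⟩
  j + d      ≤⟨ +-monoʳ-≤ j (m≤m*n d j {{>-nonZero 1≤j}}) ⟩
  j + d * j  ≤⟨ [1+d]*j≤p+c ⟩
  p + c      ∎)

[1+d]*j≤p+c⇒d*j≤p∸j+c : ∀ {c d j p} → j ≤ p → suc d * j ≤ p + c → d * j ≤ p ∸ j + c
[1+d]*j≤p+c⇒d*j≤p∸j+c {c} {d} {j} {p} j≤p [1+d]*j≤p+c = +-cancelˡ-≤ j _ _ (begin
  j + d * j        ≤⟨ [1+d]*j≤p+c ⟩
  p + c            ≡⟨ cong (_+ c) (sym (m+[n∸m]≡n j≤p)) ⟩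
  j + (p ∸ j) + c  ≡⟨ +-assoc j (p ∸ j) c ⟩
  j + (p ∸ j + c)  ∎)

m≤n⇒m∣n! : ∀ {m n} .{{_ : NonZero m}} → m ≤ n → m ∣ n !
m≤n⇒m∣n! {suc m} m≤n = ∣-trans (m∣m*n (m !)) (m≤n⇒m!∣n! m≤n)

prime∤m! : ∀ {p} → Prime p → ∀ m → m < p → p ∤ m !
prime∤m! p-prime zero    _   p∣1 = <⇒≱ (nonTrivial⇒n>1 _ {{prime⇒nonTrivial p-prime}}) (∣⇒≤ p∣1)
prime∤m! p-prime (suc m) m<p p∣m! with euclidsLemma (suc m) (m !) p-prime p∣m!
... | inj₁ p∣1+m = <⇒≱ m<p (∣⇒≤ p∣1+m)
... | inj₂ p∣m!  = prime∤m! p-prime m (<-trans (n<1+n m) m<p) p∣m!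

nCk*k![n∸k]!≡n! : ∀ {n k} → k ≤ n → (n C k) * (k ! * (n ∸ k) !) ≡ n !
nCk*k![n∸k]!≡n! {n} {k} k≤n = begin-equality
  (n C k) * (k ! * (n ∸ k) !)               ≡⟨ cong (_* (k ! * (n ∸ k) !)) (nCk≡n!/k![n-k]! k≤n) ⟩
  n ! / (k ! * (n ∸ k) !) * (k ! * (n ∸ k) !) ≡⟨ m/n*n≡m (k![n∸k]!∣n! k≤n) ⟩
  n !                                       ∎
  where instance _ = k !* (n ∸ k) !≢0

prime∣nCk : ∀ {p n k} → Prime p → k < p → n ∸ k < p → p ≤ n → p ∣ n C k
prime∣nCk {p} {n} {k} p-prime k<p n∸k<p p≤n with euclidsLemma (n C k) _ p-prime p∣nCk*k![n∸k]!
  where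
  p∣nCk*k![n∸k]! : p ∣ (n C k) * (k ! * (n ∸ k) !)
  p∣nCk*k![n∸k]! = subst (p ∣_) (sym (nCk*k![n∸k]!≡n! (<⇒≤ (<-≤-trans k<p p≤n))))
                         (m≤n⇒m∣n! {{prime⇒nonZero p-prime}} p≤n)
... | inj₁ p∣nCk = p∣nCk
... | inj₂ p∣k!*[n∸k]! with euclidsLemma (k !) _ p-prime p∣k!*[n∸k]!
...   | inj₁ p∣k!     = contradiction p∣k! (prime∤m! p-prime k k<p)
...   | inj₂ p∣[n∸k]! = contradiction p∣[n∸k]! (prime∤m! p-prime (n ∸ k) n∸k<p)

prime∣[2k]Ck : ∀ {p k} → Prime p → k < p → p ≤ 2 * k → p ∣ (2 * k) C k
prime∣[2k]Ck {k = k} p-prime k<p = prime∣nCk p-prime k<p (subst (_< _) (sym 2k∸k≡k) k<p)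
  where
  2k∸k≡k : 2 * k ∸ k ≡ k
  2k∸k≡k = trans (m+n∸m≡n k (k + 0)) (+-identityʳ k)

n<m⇒falling[n,m]≡0 : ∀ {n m} → n < m → falling (+ n) m ≡ + 0
n<m⇒falling[n,m]≡0 {zero}  {suc m} _         = ℤ.*-zeroˡ (falling (ℤ.- + 1) m)
n<m⇒falling[n,m]≡0 {suc n} {suc m} (s≤s n<m) =
  trans (cong (+ suc n ℤ.*_) (n<m⇒falling[n,m]≡0 n<m)) (ℤ.*-zeroʳ (+ suc n))

n<m⇒gbinom[n,m]≡0 : ∀ {n m} → n < m → gbinom (+ n) m ≡ + 0
n<m⇒gbinom[n,m]≡0 {m = m} n<m rewrite n<m⇒falling[n,m]≡0 n<m = cong +_ (0/n≡0 (m !) {{m !≢0}})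

s7-summand : ℕ → ℕ → ℕ
s7-summand n k = (n C k) * (n C k) * ((n + k) C k) * ((2 * k) C n)

prime∣s7-summand : ∀ {p n j} → Prime p → n + j ≡ p → n < p → 2 * j ≤ n + 1 →
                   ∀ k → k ≤ n → p ∣ s7-summand n k
prime∣s7-summand {p} {n} {j} p-prime n+j≡p n<p 2j≤n+1 k k≤n with j ≤? k
... | yes j≤k = ∣m⇒∣m*n _ (∣n⇒∣m*n ((n C k) * (n C k)) p∣[n+k]Ck)
  where
  p∣[n+k]Ck : p ∣ (n + k) C k
  p∣[n+k]Ck = prime∣nCk p-prime (≤-<-trans k≤n n<p) (subst (_< p) (sym (m+n∸n≡m n k)) n<p)
                        (subst (_≤ n + k) n+j≡p (+-monoʳ-≤ n j≤k))
... | no j≰k = subst (p ∣_) (sym s7-summand≡0) (p ∣0)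
  where
  2k<n : 2 * k < n
  2k<n = +-cancelʳ-≤ 1 _ n (begin
    suc (2 * k) + 1  ≡⟨ solve (k ∷ []) ⟩
    2 * suc k        ≤⟨ *-monoʳ-≤ 2 (≰⇒> j≰k) ⟩
    2 * j            ≤⟨ 2j≤n+1 ⟩
    n + 1            ∎)
  s7-summand≡0 : s7-summand n k ≡ 0
  s7-summand≡0 = trans (cong ((n C k) * (n C k) * ((n + k) C k) *_) (k>n⇒nCk≡0 2k<n))
                        (*-zeroʳ ((n C k) * (n C k) * ((n + k) C k)))

prime∣s7 : ∀ {p n j} → Prime p → n + j ≡ p → 1 ≤ j → 2 * j ≤ n + 1 → p ∣ s7 n
prime∣s7 {n = n} p-prime n+j≡p 1≤j 2j≤n+1 =
  ∣-sumℕ n (s7-summand n)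
    (prime∣s7-summand p-prime n+j≡p (subst (n <_) n+j≡p (m<m+n n 1≤j)) 2j≤n+1)

2m<n+j⇒m<2k : ∀ {n j k m} → 3 * j ≤ n + 2 → k + m ≡ n → 2 * m < n + j → m < 2 * k
2m<n+j⇒m<2k {n} {j} {k} {m} 3j≤n+2 k+m≡n 2m<n+j =
  *-cancelˡ-< 2 m (2 * k) (+-cancelˡ-< (4 * m + 2) (2 * m) (2 * (2 * k)) (begin
    suc (4 * m + 2 + 2 * m)   ≡⟨ solve (m ∷ []) ⟩
    3 * suc (2 * m)           ≤⟨ *-monoʳ-≤ 3 2m<n+j ⟩
    3 * (n + j)               ≡⟨ solve (n ∷ j ∷ []) ⟩
    3 * n + 3 * j             ≤⟨ +-monoʳ-≤ (3 * n) 3j≤n+2 ⟩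
    3 * n + (n + 2)           ≡⟨ cong (λ x → 3 * x + (x + 2)) (sym k+m≡n) ⟩
    3 * (k + m) + (k + m + 2) ≡⟨ solve (k ∷ m ∷ []) ⟩
    4 * m + 2 + 2 * (2 * k)   ∎))

gbinom[2n-3k,n]≡0 : ∀ {n k m} → k + m ≡ n → m < 2 * k → k < 2 * m →
                    gbinom (+ (2 * n) ℤ.- + (3 * k)) n ≡ + 0
gbinom[2n-3k,n]≡0 {n} {k} {m} k+m≡n m<2k k<2m =
  trans (cong (λ x → gbinom x n) 2n-3k≡2n∸3k) (n<m⇒gbinom[n,m]≡0 2n∸3k<n)
  where
  n<3k : n < 3 * k
  n<3k = begin-strict
    n          ≡⟨ sym k+m≡n ⟩
    k + m      <⟨ +-monoʳ-< k m<2k ⟩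
    k + 2 * k  ≡⟨ solve (k ∷ []) ⟩
    3 * k      ∎
  3k≤2n : 3 * k ≤ 2 * n
  3k≤2n = begin
    3 * k          ≡⟨ solve (k ∷ []) ⟩
    2 * k + k      ≤⟨ +-monoʳ-≤ (2 * k) (<⇒≤ k<2m) ⟩
    2 * k + 2 * m  ≡⟨ solve (k ∷ m ∷ []) ⟩
    2 * (k + m)    ≡⟨ cong (2 *_) k+m≡n ⟩
    2 * n          ∎
  2n∸3k<n : 2 * n ∸ 3 * k < n
  2n∸3k<n = begin-strict
    2 * n ∸ 3 * k  <⟨ ∸-monoʳ-< n<3k 3k≤2n ⟩
    2 * n ∸ n      ≡⟨ trans (m+n∸m≡n n (n + 0)) (+-identityʳ n) ⟩
    n              ∎
  2n-3k≡2n∸3k : + (2 * n) ℤ.- + (3 * k) ≡ + (2 * n ∸ 3 * k)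
  2n-3k≡2n∸3k = trans (ℤ.[+m]-[+n]≡m⊖n (2 * n) (3 * k)) (ℤ.⊖-≥ 3k≤2n)

s18-summand : ℕ → ℕ → ℤ
s18-summand n k = sgn k ℤ.* + ((n C k) * ((2 * k) C k) * ((2 * (n ∸ k)) C (n ∸ k)))
                  ℤ.* gbinom (+ (2 * n) ℤ.- + (3 * k)) n

∣coefficient⇒∣s18-summand : ∀ {p} n k → p ∣ (n C k) * ((2 * k) C k) * ((2 * (n ∸ k)) C (n ∸ k)) →
                             + p ℤ.∣ s18-summand n k
∣coefficient⇒∣s18-summand n k p∣a = ℤ.∣m⇒∣m*n _ (ℤ.∣n⇒∣m*n (sgn k) (ℤ.∣ᵤ⇒∣ p∣a))

prime∣s18-summand : ∀ {p n j} → Prime p → n + j ≡ p → n < p → 3 * j ≤ n + 2 →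
                    ∀ k → k ≤ n → + p ℤ.∣ s18-summand n k
prime∣s18-summand {p} {n} {j} p-prime n+j≡p n<p 3j≤n+2 k k≤n
  with p ≤? 2 * k | p ≤? 2 * (n ∸ k)
... | yes p≤2k | _ =
  ∣coefficient⇒∣s18-summand n k
    (∣m⇒∣m*n _ (∣n⇒∣m*n (n C k) (prime∣[2k]Ck p-prime (≤-<-trans k≤n n<p) p≤2k)))
... | no _ | yes p≤2[n∸k] =
  ∣coefficient⇒∣s18-summand n k (∣n⇒∣m*n ((n C k) * ((2 * k) C k))
    (prime∣[2k]Ck p-prime (≤-<-trans (m∸n≤m n k) n<p) p≤2[n∸k]))
... | no p≰2k | no p≰2[n∸k] = subst (+ p ℤ.∣_) (sym s18-summand≡0) (ℤ.∣ᵤ⇒∣ (p ∣0))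
  where
  m = n ∸ k
  k+m≡n : k + m ≡ n
  k+m≡n = m+[n∸m]≡n k≤n
  2k<n+j : 2 * k < n + j
  2k<n+j = subst (2 * k <_) (sym n+j≡p) (≰⇒> p≰2k)
  2m<n+j : 2 * m < n + j
  2m<n+j = subst (2 * m <_) (sym n+j≡p) (≰⇒> p≰2[n∸k])
  s18-summand≡0 : s18-summand n k ≡ + 0
  s18-summand≡0 = trans
    (cong (sgn k ℤ.* + ((n C k) * ((2 * k) C k) * ((2 * m) C m)) ℤ.*_)
          (gbinom[2n-3k,n]≡0 k+m≡n (2m<n+j⇒m<2k {k = k} 3j≤n+2 k+m≡n 2m<n+j)
                                   (2m<n+j⇒m<2k {k = m} 3j≤n+2 (trans (+-comm m k) k+m≡n) 2k<n+j)))
    (ℤ.*-zeroʳ (sgn k ℤ.* + ((n C k) * ((2 * k) C k) * ((2 * m) C m))))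

prime∣s18 : ∀ {p n j} → Prime p → n + j ≡ p → 1 ≤ j → 3 * j ≤ n + 2 → + p ℤ.∣ s18 n
prime∣s18 {n = n} p-prime n+j≡p 1≤j 3j≤n+2 =
  ∣-sumℤ n (s18-summand n)
    (prime∣s18-summand p-prime n+j≡p (subst (n <_) n+j≡p (m<m+n n 1≤j)) 3j≤n+2)

theorem6p6 : (p : ℕ) → Prime p →
    ((j : ℕ) → 1 ≤ j → j ≤ (p + 1) / 3 → p ∣ s7 (p ∸ j))
    × ((j : ℕ) → 1 ≤ j → j ≤ (p + 2) / 4 → (+ p) ∣ℤ s18 (p ∸ j))
theorem6p6 p p-prime = s7-case , s18-case
  where
  s7-case : (j : ℕ) → 1 ≤ j → j ≤ (p + 1) / 3 → p ∣ s7 (p ∸ j)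
  s7-case j 1≤j j≤[p+1]/3 =
    prime∣s7 p-prime (m∸n+n≡m j≤p) 1≤j ([1+d]*j≤p+c⇒d*j≤p∸j+c {d = 2} j≤p 3j≤p+1)
    where
    3j≤p+1 : 3 * j ≤ p + 1
    3j≤p+1 = m≤n/o⇒o*m≤n j (p + 1) 3 j≤[p+1]/3
    j≤p : j ≤ p
    j≤p = [1+d]*j≤p+c⇒j≤p (n≤1+n 1) 1≤j 3j≤p+1

  s18-case : (j : ℕ) → 1 ≤ j → j ≤ (p + 2) / 4 → (+ p) ∣ℤ s18 (p ∸ j)
  s18-case j 1≤j j≤[p+2]/4 =
    ℤ.∣⇒∣ᵤ (prime∣s18 p-prime (m∸n+n≡m j≤p) 1≤j ([1+d]*j≤p+c⇒d*j≤p∸j+c {d = 3} j≤p 4j≤p+2))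
    where
    4j≤p+2 : 4 * j ≤ p + 2
    4j≤p+2 = m≤n/o⇒o*m≤n j (p + 2) 4 j≤[p+2]/4
    j≤p : j ≤ p
    j≤p = [1+d]*j≤p+c⇒j≤p (n≤1+n 2) 1≤j 4j≤p+2
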